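{- There is an absolute constant $C$ such that for every pattern graph $G$ with $r\ge1$ edges, the number of strict patterns with pattern graph $G$ is at most $2^{C\cdot 2^r}$.
   Context: $E_k=\{v_iv_{i+1}:0\le i<k\}$ are the edges of the path $P_k$ on $V_k=\{v_0,\dots,v_k\}$. A pattern graph is $G=(V_G,E_G)$ with $E_G\subseteq E_k$ and $V_G$ the endpoints of $E_G$. A (non-empty) pattern is a rooted unordered binary tree (each internal node has exactly two children) whose leaves are labeled by elements of $E_k$; its pattern graph $G_A$ has edge set the set of leaf labels. A sub-pattern of $A$ is the subtree consisting of a node of $A$ and all its descendants; $\preceq$ and $\prec$ denote sub-pattern and strict sub-pattern. A pattern $\alpha$ is strict if $G_{\alpha''}$ is a proper subgraph of $G_{\alpha'}$ for all $\alpha''\prec\alpha'\preceq\alpha$. -}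

module Defs where

open import Data.Nat using (ℕ)
open import Data.Fin using (Fin)
open import Data.Fin.Subset using (Subset; ⁅_⁆; _∪_; _⊂_)
open import Data.Product using (_×_)
open import Data.Sum using (_⊎_)

-- The path P_k has edges e_i = v_i v_{i+1}, 0 ≤ i < k; we index them by Fin k.
-- A pattern graph is determined by its edge set E_G ⊆ E_k (V_G = endpoints),
-- so we represent a pattern graph on P_k as a Subset k of edge indices.
PatternGraph : ℕ → Set
PatternGraph k = Subset k

-- This datatype is ORDERED; unordered
-- trees are its quotient by _≅_ below (swapping children).
data Pattern (k : ℕ) : Set where
  leaf : Fin k → Pattern k
  node : Pattern k → Pattern k → Pattern k

data _≅_ {k : ℕ} : Pattern k → Pattern k → Set where
  leaf≅ : ∀ e → leaf e ≅ leaf e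
  node≅ : ∀ {a b c d} → (a ≅ c × b ≅ d) ⊎ (a ≅ d × b ≅ c) → node a b ≅ node c d

graph : ∀ {k} → Pattern k → PatternGraph k
graph (leaf e)   = ⁅ e ⁆
graph (node a b) = graph a ∪ graph b

data _⪯_ {k : ℕ} : Pattern k → Pattern k → Set where
  here  : ∀ {a} → a ⪯ a
  left  : ∀ {a l r} → a ⪯ l → a ⪯ node l r
  right : ∀ {a l r} → a ⪯ r → a ⪯ node l r

data _≺_ {k : ℕ} : Pattern k → Pattern k → Set where
  left  : ∀ {a l r} → a ⪯ l → a ≺ node l r
  right : ∀ {a l r} → a ⪯ r → a ≺ node l r

-- Strict pattern: G_{α''} is a proper subgraph of G_{α'} whenever α'' ≺ α' ⪯ α.
-- (Proper subgraph of pattern graphs = proper subset of edge sets, since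
-- vertex sets are the endpoints of the edges.)
Strict : ∀ {k} → Pattern k → Set
Strict {k} α = ∀ (α'' α' : Pattern k) → α'' ≺ α' → α' ⪯ α → graph α'' ⊂ graph α'

-- A strict pattern is a leaf or a node whose two children are strict patterns
-- whose graphs are proper subsets of the node's graph.  So every strict pattern
-- with r edges is found, by recursion on the size bound n = r, among the
-- candidates for a subset S with |S| ≤ n: the leaves labelled by S, and the
-- nodes over two candidates for subsets T ⊆ S with |T| ≤ n - 1.  There are at
-- most 2 ^ n such T, so if e(n) bounds the logarithm of the number of
-- candidates, e(n + 1) = 1 + 2 (n + 1 + e(n)) works, and e(n) ≤ 5 · 2 ^ n.
module Submission where

open import Defs
open import Data.Bool using (true; false)
open import Data.Nat using (ℕ; zero; suc; _+_; _*_; _^_; _≤_; _<_; z≤n; s≤s; _≤?_; >-nonZero)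
open import Data.Nat.Properties
open import Data.Nat.Solver using (module +-*-Solver)
open import Data.Fin using (Fin) renaming (zero to fzero; suc to fsuc)
open import Data.Fin.Subset using (Subset; ∣_∣; _⊂_) renaming (_∈_ to _∈ₛ_; _⊆_ to _⊆ₛ_)
open import Data.Fin.Subset.Properties using (p⊂q⇒∣p∣<∣q∣; drop-∷-⊆; x∈⁅x⁆)
open import Data.Vec using ([]; _∷_; here; there)
open import Data.List
  using (List; []; _∷_; [_]; length; map; _++_; concatMap; filter; cartesianProductWith)
open import Data.List.Properties using (length-map; length-++; length-filter; length-removeAt′)
open import Data.List.Membership.Propositional using (_∈_; lose)
open import Data.List.Membership.Propositional.Properties
  using (∈-map⁺; ∈-++⁺ˡ; ∈-++⁺ʳ; ∈-concatMap⁺; ∈-filter⁺; ∈-cartesianProductWith⁺)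
open import Data.List.Relation.Binary.Subset.Propositional using (_⊆_)
open import Data.List.Relation.Unary.All as All using (All)
open import Data.List.Relation.Unary.All.Properties using (all-filter)
open import Data.List.Relation.Unary.AllPairs as AllPairs using (AllPairs)
open import Data.List.Relation.Unary.Any using (here; there; _─_)
open import Data.List.Relation.Unary.Unique.Propositional using (Unique)
open import Data.Product using (∃-syntax; _×_; _,_; proj₁)
open import Data.Sum using (inj₁)
open import Relation.Binary.PropositionalEquality
  using (_≡_; _≢_; refl; trans; cong; cong₂; module ≡-Reasoning)
open import Relation.Nullary using (¬_; contradiction)

private
  variable
    A B C : Set
    k n : ℕ

length-concatMap-≤ : (f : A → List B) {b : ℕ} {xs : List A} →
                     All (λ x → length (f x) ≤ b) xs →
                     length (concatMap f xs) ≤ length xs * b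
length-concatMap-≤ f All.[]                             = z≤n
length-concatMap-≤ f {xs = x ∷ xs} (fx≤b All.∷ rest) rewrite length-++ (f x) {concatMap f xs} =
  +-mono-≤ fx≤b (length-concatMap-≤ f rest)

length-cartesianProductWith : (f : A → B → C) (xs : List A) (ys : List B) →
                              length (cartesianProductWith f xs ys) ≡ length xs * length ys
length-cartesianProductWith f []       ys = refl
length-cartesianProductWith f (x ∷ xs) ys = begin
  length (map (f x) ys ++ cartesianProductWith f xs ys)
    ≡⟨ length-++ (map (f x) ys) ⟩
  length (map (f x) ys) + length (cartesianProductWith f xs ys)
    ≡⟨ cong₂ _+_ (length-map (f x) ys) (length-cartesianProductWith f xs ys) ⟩
  length ys + length xs * length ys ∎
  where open ≡-Reasoning

∈-─⁺ : {x y : A} {ys : List A} (x∈ys : x ∈ ys) → y ∈ ys → y ≢ x → y ∈ (ys ─ x∈ys)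
∈-─⁺ (here refl)  (here refl)  y≢x = contradiction refl y≢x
∈-─⁺ (here refl)  (there y∈ys) _   = y∈ys
∈-─⁺ (there _)    (here refl)  _   = here refl
∈-─⁺ (there x∈ys) (there y∈ys) y≢x = there (∈-─⁺ x∈ys y∈ys y≢x)

Unique∧⊆⇒length≤ : {xs ys : List A} → Unique xs → xs ⊆ ys → length xs ≤ length ys
Unique∧⊆⇒length≤ {xs = []}     _                      _     = z≤n
Unique∧⊆⇒length≤ {xs = x ∷ xs} {ys} (x≢xs AllPairs.∷ uniq) xs⊆ys = begin
  suc (length xs)          ≤⟨ s≤s (Unique∧⊆⇒length≤ uniq xs⊆ys─x) ⟩
  suc (length (ys ─ x∈ys)) ≡⟨ length-removeAt′ ys _ ⟨
  length ys                ∎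
  where
    open ≤-Reasoning
    x∈ys = xs⊆ys (here refl)
    xs⊆ys─x : xs ⊆ (ys ─ x∈ys)
    xs⊆ys─x y∈xs = ∈-─⁺ x∈ys (xs⊆ys (there y∈xs)) λ { refl → All.lookup x≢xs y∈xs refl }

elements : Subset n → List (Fin n)
elements []          = []
elements (false ∷ p) = map fsuc (elements p)
elements (true ∷ p)  = fzero ∷ map fsuc (elements p)

length-elements : (p : Subset n) → length (elements p) ≡ ∣ p ∣
length-elements []          = refl
length-elements (false ∷ p) = trans (length-map fsuc (elements p)) (length-elements p)
length-elements (true ∷ p)  = cong suc (trans (length-map fsuc (elements p)) (length-elements p))

∈-elements : {p : Subset n} {x : Fin n} → x ∈ₛ p → x ∈ elements p
∈-elements here = here refl
∈-elements {p = false ∷ p} (there x∈p) = ∈-map⁺ fsuc (∈-elements x∈p)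
∈-elements {p = true ∷ p}  (there x∈p) = there (∈-map⁺ fsuc (∈-elements x∈p))

subsets : Subset n → List (Subset n)
subsets []          = [ [] ]
subsets (false ∷ p) = map (false ∷_) (subsets p)
subsets (true ∷ p)  = map (false ∷_) (subsets p) ++ map (true ∷_) (subsets p)

length-subsets : (p : Subset n) → length (subsets p) ≡ 2 ^ ∣ p ∣
length-subsets []          = refl
length-subsets (false ∷ p) = begin
  length (map (false ∷_) (subsets p)) ≡⟨ length-map (false ∷_) (subsets p) ⟩
  length (subsets p)                  ≡⟨ length-subsets p ⟩
  2 ^ ∣ p ∣                           ∎
  where open ≡-Reasoning
length-subsets (true ∷ p)  = begin
  length (map (false ∷_) (subsets p) ++ map (true ∷_) (subsets p))
    ≡⟨ length-++ (map (false ∷_) (subsets p)) ⟩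
  length (map (false ∷_) (subsets p)) + length (map (true ∷_) (subsets p))
    ≡⟨ cong₂ _+_ (length-map (false ∷_) (subsets p)) (length-map (true ∷_) (subsets p)) ⟩
  length (subsets p) + length (subsets p)
    ≡⟨ cong (λ m → m + m) (length-subsets p) ⟩
  2 ^ ∣ p ∣ + 2 ^ ∣ p ∣
    ≡⟨ cong (2 ^ ∣ p ∣ +_) (+-identityʳ (2 ^ ∣ p ∣)) ⟨
  2 ^ suc ∣ p ∣ ∎
  where open ≡-Reasoning

∈-subsets : {p q : Subset n} → q ⊆ₛ p → q ∈ subsets p
∈-subsets {p = []}        {[]}        _   = here refl
∈-subsets {p = false ∷ p} {false ∷ q} q⊆p = ∈-map⁺ (false ∷_) (∈-subsets (drop-∷-⊆ q⊆p))
∈-subsets {p = false ∷ p} {true ∷ q}  q⊆p = contradiction (q⊆p here) λ ()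
∈-subsets {p = true ∷ p}  {false ∷ q} q⊆p =
  ∈-++⁺ˡ (∈-map⁺ (false ∷_) (∈-subsets (drop-∷-⊆ q⊆p)))
∈-subsets {p = true ∷ p}  {true ∷ q}  q⊆p =
  ∈-++⁺ʳ (map (false ∷_) (subsets p)) (∈-map⁺ (true ∷_) (∈-subsets (drop-∷-⊆ q⊆p)))

n<2^n : ∀ n → n < 2 ^ n
n<2^n zero    = s≤s z≤n
n<2^n (suc n) = begin-strict
  suc n             ≡⟨ +-comm 1 n ⟩
  n + 1             <⟨ +-mono-<-≤ (n<2^n n) (m^n>0 2 n) ⟩
  2 ^ n + 2 ^ n     ≡⟨ cong (2 ^ n +_) (+-identityʳ (2 ^ n)) ⟨
  2 ^ suc n         ∎
  where open ≤-Reasoning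

m+[2^m]²≤2^[1+2m] : ∀ m → m + 2 ^ m * 2 ^ m ≤ 2 ^ suc (m + m)
m+[2^m]²≤2^[1+2m] m = begin
  m + 2 ^ m * 2 ^ m                 ≤⟨ +-monoˡ-≤ (2 ^ m * 2 ^ m) m≤[2^m]² ⟩
  2 ^ m * 2 ^ m + 2 ^ m * 2 ^ m     ≡⟨ cong (2 ^ m * 2 ^ m +_) (+-identityʳ (2 ^ m * 2 ^ m)) ⟨
  2 * (2 ^ m * 2 ^ m)               ≡⟨ cong (2 *_) (^-distribˡ-+-* 2 m m) ⟨
  2 ^ suc (m + m)                   ∎
  where
    open ≤-Reasoning
    m≤[2^m]² : m ≤ 2 ^ m * 2 ^ m
    m≤[2^m]² = ≤-trans (<⇒≤ (n<2^n m)) (m≤m*n (2 ^ m) (2 ^ m) {{>-nonZero (m^n>0 2 m)}})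

exponent : ℕ → ℕ
exponent zero    = 0
exponent (suc n) = suc (m + m)
  where m = suc n + exponent n

exponent≤5*2^n : ∀ n → exponent n ≤ 5 * 2 ^ n
exponent≤5*2^n n = m+n≤o⇒m≤o (exponent n) (invariant n)
  where
    open +-*-Solver
    invariant : ∀ n → exponent n + (n + n + 5) ≤ 5 * 2 ^ n
    invariant zero    = ≤-refl
    invariant (suc n) = begin
      exponent (suc n) + (suc n + suc n + 5)
        ≡⟨ solve 2 (λ e n → (con 1 :+ ((con 1 :+ n :+ e) :+ (con 1 :+ n :+ e)))
                              :+ ((con 1 :+ n) :+ (con 1 :+ n) :+ con 5)
                            := (e :+ (n :+ n :+ con 5)) :+ (e :+ (n :+ n :+ con 5)))
                   refl (exponent n) n ⟩
      (exponent n + (n + n + 5)) + (exponent n + (n + n + 5))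
        ≤⟨ +-mono-≤ (invariant n) (invariant n) ⟩
      5 * 2 ^ n + 5 * 2 ^ n
        ≡⟨ solve 1 (λ t → con 5 :* t :+ con 5 :* t := con 5 :* (t :+ (t :+ con 0))) refl (2 ^ n) ⟩
      5 * 2 ^ suc n ∎
      where open ≤-Reasoning

≅-refl : (α : Pattern k) → α ≅ α
≅-refl (leaf e)   = leaf≅ e
≅-refl (node α β) = node≅ (inj₁ (≅-refl α , ≅-refl β))

≇⇒≢ : {α β : Pattern k} → ¬ α ≅ β → α ≢ β
≇⇒≢ α≇β refl = α≇β (≅-refl _)

Strict-left : {α β : Pattern k} → Strict (node α β) → Strict α
Strict-left isStrict α'' α' α''≺α' α'⪯α = isStrict α'' α' α''≺α' (left α'⪯α)

Strict-right : {α β : Pattern k} → Strict (node α β) → Strict β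
Strict-right isStrict α'' α' α''≺α' α'⪯β = isStrict α'' α' α''≺α' (right α'⪯β)

smallSubsets : ℕ → Subset k → List (Subset k)
smallSubsets n S = filter (λ T → ∣ T ∣ ≤? n) (subsets S)

candidates      : ℕ → Subset k → List (Pattern k)
childCandidates : ℕ → Subset k → List (Pattern k)

candidates zero    S = map leaf (elements S)
candidates (suc n) S = map leaf (elements S) ++
                       cartesianProductWith node (childCandidates n S) (childCandidates n S)

childCandidates n S = concatMap (candidates n) (smallSubsets n S)

length-candidates      : (S : Subset k) → ∣ S ∣ ≤ n →
                         length (candidates n S) ≤ 2 ^ exponent n
length-childCandidates : (S : Subset k) → ∣ S ∣ ≤ suc n →
                         length (childCandidates n S) ≤ 2 ^ (suc n + exponent n)

length-candidates {n = zero} S |S|≤0 = begin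
  length (map leaf (elements S)) ≡⟨ length-map leaf (elements S) ⟩
  length (elements S)            ≡⟨ length-elements S ⟩
  ∣ S ∣                          ≤⟨ ≤-trans |S|≤0 z≤n ⟩
  1                              ∎
  where open ≤-Reasoning
length-candidates {n = suc n} S |S|≤1+n = begin
  length (map leaf (elements S) ++ cartesianProductWith node cs cs)
    ≡⟨ length-++ (map leaf (elements S)) ⟩
  length (map leaf (elements S)) + length (cartesianProductWith node cs cs)
    ≡⟨ cong₂ _+_ (trans (length-map leaf (elements S)) (length-elements S))
                 (length-cartesianProductWith node cs cs) ⟩
  ∣ S ∣ + length cs * length cs
    ≤⟨ +-mono-≤ (≤-trans |S|≤1+n (m≤m+n (suc n) (exponent n)))
                (*-mono-≤ (length-childCandidates S |S|≤1+n) (length-childCandidates S |S|≤1+n)) ⟩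
  m + 2 ^ m * 2 ^ m
    ≤⟨ m+[2^m]²≤2^[1+2m] m ⟩
  2 ^ exponent (suc n) ∎
  where
    open ≤-Reasoning
    cs = childCandidates n S
    m  = suc n + exponent n

length-childCandidates {n = n} S |S|≤1+n = begin
  length (concatMap (candidates n) (smallSubsets n S))
    ≤⟨ length-concatMap-≤ (candidates n)
         (All.map (length-candidates _) (all-filter (λ T → ∣ T ∣ ≤? n) (subsets S))) ⟩
  length (smallSubsets n S) * 2 ^ exponent n
    ≤⟨ *-monoˡ-≤ (2 ^ exponent n) (length-filter (λ T → ∣ T ∣ ≤? n) (subsets S)) ⟩
  length (subsets S) * 2 ^ exponent n
    ≡⟨ cong (_* 2 ^ exponent n) (length-subsets S) ⟩
  2 ^ ∣ S ∣ * 2 ^ exponent n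
    ≤⟨ *-monoˡ-≤ (2 ^ exponent n) (^-monoʳ-≤ 2 |S|≤1+n) ⟩
  2 ^ suc n * 2 ^ exponent n
    ≡⟨ ^-distribˡ-+-* 2 (suc n) (exponent n) ⟨
  2 ^ (suc n + exponent n) ∎
  where open ≤-Reasoning

Strict⇒∈candidates      : (α : Pattern k) → Strict α → ∣ graph α ∣ ≤ n →
                          α ∈ candidates n (graph α)
Strict⇒∈childCandidates : {S : Subset k} (α : Pattern k) → Strict α →
                          graph α ⊂ S → ∣ S ∣ ≤ suc n → α ∈ childCandidates n S

Strict⇒∈candidates {n = zero}  (leaf e) _ _ = ∈-map⁺ leaf (∈-elements (x∈⁅x⁆ e))
Strict⇒∈candidates {n = suc n} (leaf e) _ _ = ∈-++⁺ˡ (∈-map⁺ leaf (∈-elements (x∈⁅x⁆ e)))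
Strict⇒∈candidates {n = zero}  (node α β) isStrict |G|≤0 =
  contradiction (≤-trans (p⊂q⇒∣p∣<∣q∣ (isStrict α (node α β) (left here) here)) |G|≤0) λ ()
Strict⇒∈candidates {n = suc n} (node α β) isStrict |G|≤1+n =
  ∈-++⁺ʳ (map leaf (elements (graph (node α β))))
    (∈-cartesianProductWith⁺ node
      (Strict⇒∈childCandidates α (Strict-left isStrict)
        (isStrict α (node α β) (left here) here) |G|≤1+n)
      (Strict⇒∈childCandidates β (Strict-right isStrict)
        (isStrict β (node α β) (right here) here) |G|≤1+n))

Strict⇒∈childCandidates {n = n} α isStrict α⊂S |S|≤1+n =
  ∈-concatMap⁺ (candidates n)
    (lose (∈-filter⁺ (λ T → ∣ T ∣ ≤? n) (∈-subsets (proj₁ α⊂S)) |α|≤n)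
          (Strict⇒∈candidates α isStrict |α|≤n))
  where
    |α|≤n : ∣ graph α ∣ ≤ n
    |α|≤n = ≤-pred (≤-trans (p⊂q⇒∣p∣<∣q∣ α⊂S) |S|≤1+n)

strictWithGraph⊆candidates : {G : Subset k} {As : List (Pattern k)} →
                             All (λ A → Strict A × graph A ≡ G) As → As ⊆ candidates ∣ G ∣ G
strictWithGraph⊆candidates strictWithGraphG {A} A∈As with All.lookup strictWithGraphG A∈As
... | isStrict , refl = Strict⇒∈candidates A isStrict ≤-refl

lemma9p3 : ∃[ C ] ∀ (k : ℕ) (G : PatternGraph k) → 1 ≤ ∣ G ∣ →
           ∀ (As : List (Pattern k)) →
           All (λ A → Strict A × graph A ≡ G) As →
           AllPairs (λ A B → ¬ (A ≅ B)) As →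
           length As ≤ 2 ^ (C * 2 ^ ∣ G ∣)
lemma9p3 = 5 , λ k G _ As strictWithGraphG pairwiseNonIsomorphic → begin
  length As
    ≤⟨ Unique∧⊆⇒length≤ (AllPairs.map ≇⇒≢ pairwiseNonIsomorphic)
                        (strictWithGraph⊆candidates strictWithGraphG) ⟩
  length (candidates ∣ G ∣ G)  ≤⟨ length-candidates G ≤-refl ⟩
  2 ^ exponent ∣ G ∣            ≤⟨ ^-monoʳ-≤ 2 (exponent≤5*2^n ∣ G ∣) ⟩
  2 ^ (5 * 2 ^ ∣ G ∣)           ∎
  where open ≤-Reasoning
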